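{- Let $R$ be a finite set, let $t\ge 0$ be an integer, and let $\mathcal C\subseteq 2^R$ be a family such that $C'\not\subseteq C$ for all distinct $C,C'\in\mathcal C$, and every member of $\mathcal C$ has size at least $t$. If $\lambda\ge|R|$ (and $\lambda>0$), then $$\sum_{C\in\mathcal C}\lambda^{ -|C|}\le\lambda^{ -t}\binom{|R|}{t}.$$
   Formalization: The parameter λ ranges over the rationals. -}

module Defs where

open import Data.Nat using (ℕ; zero; suc)
open import Data.Rational using (ℚ; 0ℚ; 1ℚ; _+_; _*_; _<_; 1/_; positive)
open import Data.Rational.Properties using (pos⇒nonZero)
open import Data.List using (List; []; _∷_)

_^ℚ_ : ℚ → ℕ → ℚ
q ^ℚ zero  = 1ℚ
q ^ℚ suc k = q * (q ^ℚ k)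

invPow : (lam : ℚ) → 0ℚ < lam → ℕ → ℚ
invPow lam pos k = ((1/ lam) {{pos⇒nonZero lam {{positive pos}}}}) ^ℚ k

sumℚ : List ℚ → ℚ
sumℚ []       = 0ℚ
sumℚ (x ∷ xs) = x + sumℚ xs

open import Data.Integer using (+_)
open import Data.Rational using (_/_)

ℕtoℚ : ℕ → ℚ
ℕtoℚ m = (+ m) / 1

-- Induct on |R| = n by splitting the family according to whether it contains the
-- first element of R: writing q = 1/λ, the sets avoiding it form an antichain
-- on n − 1 points with sizes ≥ t, and the tails of the sets containing it form
-- one with sizes ≥ t − 1 that carries an extra factor q, so Pascal's rule
-- q^t C(n,t) = q^t C(n−1,t) + q · q^(t−1) C(n−1,t−1) closes the induction.
-- For t = 0 the family is either {∅}, of weight 1, or has all sizes ≥ 1 and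
-- hence weight ≤ q n ≤ 1.
module Submission where

open import Defs
open import Algebra using (CommutativeMonoid)
import Algebra.Properties.CommutativeSemigroup as CommSemigroupProperties
open import Data.Bool as Bool using (Bool; true; false)
open import Data.Empty using (⊥-elim)
import Data.Integer as ℤ
import Data.Integer.Properties as ℤ
open import Data.List using (List; []; _∷_; map)
open import Data.List.Membership.Propositional using (_∈_)
import Data.List.Membership.DecPropositional as DecMembership
open import Data.List.Relation.Unary.All as All using (All; []; _∷_)
open import Data.List.Relation.Unary.AllPairs using ([]; _∷_)
open import Data.List.Relation.Unary.Any using (here; there)
open import Data.List.Relation.Unary.Unique.Propositional using (Unique)
open import Data.Nat as ℕ using (ℕ; zero; suc; _≤_)
import Data.Nat.Coprimality as Coprimality
open import Data.Nat.Combinatorics using (_C_; nC1≡n; nCk+nC[k+1]≡[n+1]C[k+1])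
import Data.Nat.Properties as ℕ
open import Data.Fin.Subset using (Subset; _⊆_; ∣_∣; ⊥)
open import Data.Fin.Subset.Properties using (s⊆s; ⊆-min; ∣⊥∣≡0)
open import Data.Rational as ℚ using (ℚ; mkℚ; 0ℚ; 1ℚ; _+_; _*_; _<_; 1/_; *≤*; NonZero; NonNegative; positive)
  renaming (_≤_ to _≤ℚ_)
open import Data.Rational.Properties
open import Data.Vec as Vec using ([]; _∷_)
import Data.Vec.Properties as Vec
open import Relation.Binary.PropositionalEquality
open import Relation.Nullary using (yes; no)

ℕtoℚ≡mkℚ : ∀ m → ℕtoℚ m ≡ mkℚ (ℤ.+ m) 0 (Coprimality.sym (Coprimality.1-coprimeTo m))
ℕtoℚ≡mkℚ m = ↥p/↧p≡p (mkℚ (ℤ.+ m) 0 (Coprimality.sym (Coprimality.1-coprimeTo m)))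

ℕtoℚ-+ : ∀ m n → ℕtoℚ (m ℕ.+ n) ≡ ℕtoℚ m + ℕtoℚ n
ℕtoℚ-+ m n = sym (begin
  ℕtoℚ m + ℕtoℚ n
    ≡⟨ cong₂ _+_ (ℕtoℚ≡mkℚ m) (ℕtoℚ≡mkℚ n) ⟩
  (ℤ.+ m ℤ.* ℤ.+ 1 ℤ.+ ℤ.+ n ℤ.* ℤ.+ 1) ℚ./ 1
    ≡⟨ cong (ℚ._/ 1) (cong₂ ℤ._+_ (ℤ.*-identityʳ (ℤ.+ m)) (ℤ.*-identityʳ (ℤ.+ n))) ⟩
  (ℤ.+ m ℤ.+ ℤ.+ n) ℚ./ 1
    ≡⟨ cong (ℚ._/ 1) (sym (ℤ.pos-+ m n)) ⟩
  ℕtoℚ (m ℕ.+ n)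
    ∎)
  where open ≡-Reasoning

ℕtoℚ-mono-≤ : ∀ {m n} → m ≤ n → ℕtoℚ m ≤ℚ ℕtoℚ n
ℕtoℚ-mono-≤ {m} {n} m≤n rewrite ℕtoℚ≡mkℚ m | ℕtoℚ≡mkℚ n =
  *≤* (ℤ.*-monoʳ-≤-nonNeg (ℤ.+ 1) (ℤ.+≤+ m≤n))

∣p∣≡0⇒p≡⊥ : ∀ {n} (p : Subset n) → ∣ p ∣ ≡ 0 → p ≡ ⊥
∣p∣≡0⇒p≡⊥ []          _  = refl
∣p∣≡0⇒p≡⊥ (false ∷ p) eq = cong (false ∷_) (∣p∣≡0⇒p≡⊥ p eq)
∣p∣≡0⇒p≡⊥ (true  ∷ p) ()

unique-constant⇒singleton : ∀ {a} {A : Set a} {x : A} {xs : List A} →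
  Unique xs → (∀ {y} → y ∈ xs → y ≡ x) → x ∈ xs → xs ≡ x ∷ []
unique-constant⇒singleton {xs = y ∷ []}     _               all≡x _ = cong (_∷ []) (all≡x (here refl))
unique-constant⇒singleton {xs = y ∷ z ∷ zs} ((y≢z ∷ _) ∷ _) all≡x _ =
  ⊥-elim (y≢z (trans (all≡x (here refl)) (sym (all≡x (there (here refl))))))

Antichain : ∀ {n} → List (Subset n) → Set
Antichain 𝒞 = ∀ {C C′} → C ∈ 𝒞 → C′ ∈ 𝒞 → C′ ⊆ C → C′ ≡ C

fiber : ∀ {n} → Bool → List (Subset (suc n)) → List (Subset n)
fiber b []              = []
fiber b ((x ∷ C) ∷ 𝒞) with x Bool.≟ b
... | yes _ = C ∷ fiber b 𝒞
... | no  _ = fiber b 𝒞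

module _ {n : ℕ} (b : Bool) where

  ∈-fiber⁻ : ∀ (𝒞 : List (Subset (suc n))) {C} → C ∈ fiber b 𝒞 → (b ∷ C) ∈ 𝒞
  ∈-fiber⁻ ((x ∷ D) ∷ 𝒞) C∈ with x Bool.≟ b | C∈
  ... | yes refl | here refl = here refl
  ... | yes refl | there C∈′ = there (∈-fiber⁻ 𝒞 C∈′)
  ... | no  _    | C∈′       = there (∈-fiber⁻ 𝒞 C∈′)

  All-fiber : ∀ {P : Subset (suc n) → Set} {𝒞 : List (Subset (suc n))} →
    All P 𝒞 → All (λ C → P (b ∷ C)) (fiber b 𝒞)
  All-fiber [] = []
  All-fiber {𝒞 = (x ∷ D) ∷ 𝒞} (px ∷ pxs) with x Bool.≟ b
  ... | yes refl = px ∷ All-fiber pxs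
  ... | no  _    = All-fiber pxs

  Unique-fiber : ∀ {𝒞 : List (Subset (suc n))} → Unique 𝒞 → Unique (fiber b 𝒞)
  Unique-fiber [] = []
  Unique-fiber {(x ∷ D) ∷ 𝒞} (D∉ ∷ u) with x Bool.≟ b
  ... | yes refl = All.map (λ ne eq → ne (cong (b ∷_) eq)) (All-fiber D∉) ∷ Unique-fiber u
  ... | no  _    = Unique-fiber u

  Antichain-fiber : ∀ {𝒞 : List (Subset (suc n))} → Antichain 𝒞 → Antichain (fiber b 𝒞)
  Antichain-fiber {𝒞} ac C∈ C′∈ C′⊆C = cong Vec.tail (ac (∈-fiber⁻ 𝒞 C∈) (∈-fiber⁻ 𝒞 C′∈) (s⊆s C′⊆C))

module Weights (q : ℚ) {{_ : NonNegative q}} where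

  totalWeight : ∀ {n} → List (Subset n) → ℚ
  totalWeight 𝒞 = sumℚ (map (λ C → q ^ℚ ∣ C ∣) 𝒞)

  binomialBound : ℕ → ℕ → ℚ
  binomialBound n t = q ^ℚ t * ℕtoℚ (n C t)

  totalWeight-fibers : ∀ {n} (𝒞 : List (Subset (suc n))) →
    totalWeight 𝒞 ≡ totalWeight (fiber false 𝒞) + q * totalWeight (fiber true 𝒞)
  totalWeight-fibers [] = sym (trans (+-identityˡ _) (*-zeroʳ q))
  totalWeight-fibers ((false ∷ C) ∷ 𝒞) =
    trans (cong (q ^ℚ ∣ C ∣ +_) (totalWeight-fibers 𝒞)) (sym (+-assoc (q ^ℚ ∣ C ∣) W₀ (q * W₁)))
    where
    W₀ = totalWeight (fiber false 𝒞)
    W₁ = totalWeight (fiber true 𝒞)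
  totalWeight-fibers ((true ∷ C) ∷ 𝒞) = begin
    q * w + totalWeight 𝒞      ≡⟨ cong (q * w +_) (totalWeight-fibers 𝒞) ⟩
    q * w + (W₀ + q * W₁)       ≡⟨ x∙yz≈y∙xz (q * w) W₀ (q * W₁) ⟩
    W₀ + (q * w + q * W₁)       ≡⟨ cong (W₀ +_) (sym (*-distribˡ-+ q w W₁)) ⟩
    W₀ + q * (w + W₁)           ∎
    where
    open ≡-Reasoning
    open CommSemigroupProperties (CommutativeMonoid.commutativeSemigroup +-0-commutativeMonoid)
    w  = q ^ℚ ∣ C ∣
    W₀ = totalWeight (fiber false 𝒞)
    W₁ = totalWeight (fiber true 𝒞)

  binomialBound-pascal : ∀ n t →
    binomialBound n (suc t) + q * binomialBound n t ≡ binomialBound (suc n) (suc t)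
  binomialBound-pascal n t = begin
    x * N₁ + q * (q ^ℚ t * N₀)  ≡⟨ cong (x * N₁ +_) (sym (*-assoc q (q ^ℚ t) N₀)) ⟩
    x * N₁ + x * N₀              ≡⟨ sym (*-distribˡ-+ x N₁ N₀) ⟩
    x * (N₁ + N₀)                ≡⟨ cong (x *_) (+-comm N₁ N₀) ⟩
    x * (N₀ + N₁)                ≡⟨ cong (x *_) (sym (ℕtoℚ-+ (n C t) (n C suc t))) ⟩
    x * ℕtoℚ (n C t ℕ.+ n C suc t) ≡⟨ cong (λ k → x * ℕtoℚ k) (nCk+nC[k+1]≡[n+1]C[k+1] n t) ⟩
    x * ℕtoℚ (suc n C suc t)     ∎
    where
    open ≡-Reasoning
    x  = q ^ℚ suc t
    N₀ = ℕtoℚ (n C t)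
    N₁ = ℕtoℚ (n C suc t)

  binomialBound-zero : ∀ n → binomialBound n 0 ≡ 1ℚ
  binomialBound-zero n = *-identityˡ 1ℚ

  binomialBound-one : ∀ n → binomialBound n 1 ≡ q * ℕtoℚ n
  binomialBound-one n = cong₂ _*_ (*-identityʳ q) (cong ℕtoℚ (nC1≡n n))

  totalWeight-antichain∋⊥ : ∀ {n} {𝒞 : List (Subset n)} →
    Unique 𝒞 → Antichain 𝒞 → ⊥ ∈ 𝒞 → totalWeight 𝒞 ≡ 1ℚ
  totalWeight-antichain∋⊥ {n} u ac ⊥∈
    rewrite unique-constant⇒singleton u (λ A∈ → sym (ac A∈ ⊥∈ (⊆-min _))) ⊥∈
          | ∣⊥∣≡0 n
    = +-identityʳ 1ℚ

  mutual
    antichain-totalWeight≤ : ∀ n t (𝒞 : List (Subset n)) → Unique 𝒞 → Antichain 𝒞 →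
      (∀ {C} → C ∈ 𝒞 → t ≤ ∣ C ∣) → q * ℕtoℚ n ≤ℚ 1ℚ → totalWeight 𝒞 ≤ℚ binomialBound n t
    antichain-totalWeight≤ n (suc t) = antichain-totalWeight≤-suc n t
    antichain-totalWeight≤ n zero 𝒞 u ac _ qn≤1 with DecMembership._∈?_ (Vec.≡-dec Bool._≟_) ⊥ 𝒞
    ... | yes ⊥∈ = ≤-reflexive (trans (totalWeight-antichain∋⊥ u ac ⊥∈) (sym (binomialBound-zero n)))
    ... | no  ⊥∉ = begin
      totalWeight 𝒞      ≤⟨ antichain-totalWeight≤-suc n 0 𝒞 u ac nonempty qn≤1 ⟩
      binomialBound n 1  ≡⟨ binomialBound-one n ⟩
      q * ℕtoℚ n         ≤⟨ qn≤1 ⟩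
      1ℚ                 ≡⟨ binomialBound-zero n ⟨
      binomialBound n 0  ∎
      where
      open ≤-Reasoning
      nonempty : ∀ {C} → C ∈ 𝒞 → 1 ≤ ∣ C ∣
      nonempty {A} A∈ = ℕ.n≢0⇒n>0 (λ ∣A∣≡0 → ⊥∉ (subst (_∈ 𝒞) (∣p∣≡0⇒p≡⊥ A ∣A∣≡0) A∈))

    antichain-totalWeight≤-suc : ∀ n t (𝒞 : List (Subset n)) → Unique 𝒞 → Antichain 𝒞 →
      (∀ {C} → C ∈ 𝒞 → suc t ≤ ∣ C ∣) → q * ℕtoℚ n ≤ℚ 1ℚ →
      totalWeight 𝒞 ≤ℚ binomialBound n (suc t)
    antichain-totalWeight≤-suc zero t [] _ _ _ _ = ≤-reflexive (sym (*-zeroʳ (q ^ℚ suc t)))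
    antichain-totalWeight≤-suc zero t ([] ∷ _) _ _ large _ with large (here refl)
    ... | ()
    antichain-totalWeight≤-suc (suc n) t 𝒞 u ac large qn≤1 = begin
      totalWeight 𝒞
        ≡⟨ totalWeight-fibers 𝒞 ⟩
      totalWeight (fiber false 𝒞) + q * totalWeight (fiber true 𝒞)
        ≤⟨ +-mono-≤
             (antichain-totalWeight≤-suc n t (fiber false 𝒞) (Unique-fiber false u) (Antichain-fiber false ac)
               (λ C∈ → large (∈-fiber⁻ false 𝒞 C∈)) qn≤1′)
             (*-monoˡ-≤-nonNeg q
               (antichain-totalWeight≤ n t (fiber true 𝒞) (Unique-fiber true u) (Antichain-fiber true ac)
                 (λ C∈ → ℕ.s≤s⁻¹ (large (∈-fiber⁻ true 𝒞 C∈))) qn≤1′)) ⟩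
      binomialBound n (suc t) + q * binomialBound n t
        ≡⟨ binomialBound-pascal n t ⟩
      binomialBound (suc n) (suc t)
        ∎
      where
      open ≤-Reasoning
      qn≤1′ : q * ℕtoℚ n ≤ℚ 1ℚ
      qn≤1′ = ≤-trans (*-monoˡ-≤-nonNeg q (ℕtoℚ-mono-≤ (ℕ.n≤1+n n))) qn≤1

lemma4 : (n t : ℕ) (𝒞 : List (Subset n)) → Unique 𝒞
         → (∀ {C C′} → C ∈ 𝒞 → C′ ∈ 𝒞 → C′ ⊆ C → C′ ≡ C)
         → (∀ {C} → C ∈ 𝒞 → t ≤ ∣ C ∣)
         → (lam : ℚ) (pos : 0ℚ < lam) → ℕtoℚ n ≤ℚ lam
         → sumℚ (map (λ C → invPow lam pos ∣ C ∣) 𝒞) ≤ℚ invPow lam pos t * ℕtoℚ (n C t)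
lemma4 n t 𝒞 u ac large lam pos n≤lam =
  Weights.antichain-totalWeight≤ q n t 𝒞 u ac large qn≤1
  where
  instance
    lam≢0 : NonZero lam
    lam≢0 = pos⇒nonZero lam {{positive pos}}
    q≥0 : NonNegative (1/ lam)
    q≥0 = pos⇒nonNeg (1/ lam) {{1/pos⇒pos lam {{positive pos}}}}
  q : ℚ
  q = 1/ lam
  qn≤1 : q * ℕtoℚ n ≤ℚ 1ℚ
  qn≤1 = ≤-trans (*-monoˡ-≤-nonNeg q n≤lam) (≤-reflexive (*-inverseˡ lam))
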